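{- Let $L$ be a finite lattice and $(x,y,z)\in L^3$ with $x\le y\le z$. Let $S_{x,y}$ be a lower cross-cut of $[x,y]$ and $S_{y,z}$ a lower cross-cut of $[y,z]$, and put $S_{x,y,z}=S_{x,y}\sqcup S_{y,z}$. Then $$J(x,y,z)=\sum_{\substack{A\subseteq S_{x,y,z}\\ \bigvee(A\cap S_{x,y})=y\\ \bigvee(A\cap S_{y,z})=z}}(-1)^{|A|}.$$
   Context: For $u\le v$ in $L$, $[u,v]=\{a\in L: u\le a\le v\}$. A lower cross-cut of $[u,v]$ is a set $S\subseteq[u,v]\setminus\{u\}$ such that for every $b\in[u,v]\setminus(S\cup\{u\})$ there is some $a\in S$ with $a<b$. (The sets $S_{x,y}\subseteq[x,y]\setminus\{x\}$ and $S_{y,z}\subseteq[y,z]\setminus\{y\}$ are disjoint.) In the condition $\bigvee(A\cap S_{x,y})=y$, the join of the empty subset of $S_{x,y}$ is taken to be $x$ (the bottom of $[x,y]$), and similarly the join of the empty subset of $S_{y,z}$ is $y$. $J:\{(x,y,z):x\le y\le z\}\to\mathbb{Z}$ is defined by $\sum_{x\le a\le y\le b\le z} J(a,y,b)=\delta_3(x,y,z)$ for all $x\le y\le z$, where $\delta_3(x,y,z)=1$ if $x=y=z$ and $0$ otherwise. -}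

module Defs where

open import Level using (0ℓ)
open import Data.Nat using (ℕ)
open import Data.Integer using (ℤ; 0ℤ; 1ℤ; -1ℤ; _+_; _^_)
open import Data.List using (List; []; _∷_; _++_; map; filter; foldr; length)
open import Data.List.Membership.Propositional using (_∈_; _∉_)
open import Data.List.Relation.Unary.Unique.Propositional using (Unique)
open import Data.Product using (_×_; ∃-syntax; _,_)
open import Relation.Binary.Core using (Rel)
open import Relation.Binary.Definitions using (DecidableEquality; Decidable)
open import Relation.Binary.Lattice.Structures using (IsLattice)
open import Relation.Binary.PropositionalEquality using (_≡_; _≢_)
open import Relation.Nullary using (Dec; yes; no; ¬_)
open import Relation.Nullary.Decidable using (_×-dec_)
open import Algebra.Core using (Op₂)
import Data.List.Membership.DecPropositional as DecMem

record FiniteLattice : Set₁ where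
  field
    Carrier        : Set
    _≤_            : Rel Carrier 0ℓ
    _∨_            : Op₂ Carrier
    _∧_            : Op₂ Carrier
    isLattice      : IsLattice _≡_ _≤_ _∨_ _∧_
    _≟_            : DecidableEquality Carrier
    _≤?_           : Decidable _≤_
    elems          : List Carrier
    elems-complete : ∀ a → a ∈ elems
    elems-unique   : Unique elems

  infix 4 _≤_ _<_
  infixr 6 _∨_

  _<_ : Rel Carrier 0ℓ
  a < b = (a ≤ b) × (a ≢ b)

sumℤ : List ℤ → ℤ
sumℤ = foldr _+_ 0ℤ

-- All sub(multi)sets of a list, as sublists (for a list without
-- repetitions these are exactly its subsets, each listed once).
subsets : {A : Set} → List A → List (List A)
subsets []       = [] ∷ []
subsets (a ∷ as) = map (a ∷_) (subsets as) ++ subsets as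

module _ (L : FiniteLattice) where
  open FiniteLattice L

  IsLowerCrossCut : Carrier → Carrier → List Carrier → Set
  IsLowerCrossCut u v S =
      Unique S
    × (∀ a → a ∈ S → (u ≤ a) × (a ≤ v) × (a ≢ u))
    × (∀ b → u ≤ b → b ≤ v → b ∉ S → b ≢ u → ∃[ a ] ((a ∈ S) × (a < b)))

  -- Used with b the bottom of the interval
  -- containing A, so that it is ⋁A for A nonempty and b for A empty.
  joinFrom : Carrier → List Carrier → Carrier
  joinFrom b = foldr _∨_ b

  _∩_ : List Carrier → List Carrier → List Carrier
  A ∩ S = filter (λ a → DecMem._∈?_ _≟_ a S) A

  δ₃ : Carrier → Carrier → Carrier → ℤ
  δ₃ x y z with x ≟ y ×-dec y ≟ z
  ... | yes _ = 1ℤ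
  ... | no  _ = 0ℤ

  Jsum : (Carrier → Carrier → Carrier → ℤ) → Carrier → Carrier → Carrier → ℤ
  Jsum J x y z =
    sumℤ (map (λ a → sumℤ (map (λ b → J a y b)
                              (filter (λ b → y ≤? b ×-dec b ≤? z) elems)))
              (filter (λ a → x ≤? a ×-dec a ≤? y) elems))

  IsJ : (Carrier → Carrier → Carrier → ℤ) → Set
  IsJ J = ∀ x y z → x ≤ y → y ≤ z → Jsum J x y z ≡ δ₃ x y z

  crossCutSum : Carrier → Carrier → Carrier → List Carrier → List Carrier → ℤ
  crossCutSum x y z Sxy Syz =
    sumℤ (map (λ A → -1ℤ ^ length A)
              (filter (λ A → joinFrom x (A ∩ Sxy) ≟ y ×-dec joinFrom y (A ∩ Syz) ≟ z)
                      (subsets (Sxy ++ Syz))))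

-- Both sides equal μ(x,y)·μ(y,z), μ the Möbius function of L.  For a lower
-- cross-cut S of [u,v], the signed count of subsets of S by their join is
-- μ(u,·) on [u,v]: the subsets with join ≤ w are the subsets of the part of S
-- below w, which is empty exactly when w = u (Rota's cross-cut theorem).
-- The defining relation of J then forces J(w,y,·) summed over w ∈ [w₀,y] to
-- be [w₀ = y]·μ(y,·), which unfolds J(x,y,z) through the cross-cut of [x,y]
-- into μ(x,y)μ(y,z).  On the other side the two cross-cuts are disjoint, so
-- the sum over A ⊆ S_{x,y} ⊔ S_{y,z} factorises into the same product.
module Submission where

open import Defs
open import Level using (0ℓ)
open import Data.Nat as ℕ using (ℕ; z≤n; s≤s)
import Data.Nat.Properties as ℕP
import Data.Nat.Induction as ℕ-Induction
open import Data.Integer using (ℤ; 0ℤ; 1ℤ; -1ℤ; _+_; _*_; -_; _-_; _^_)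
import Data.Integer.Properties as ℤP
open import Data.Integer.Tactic.RingSolver using (solve-∀)
open import Data.List using (List; []; _∷_; _++_; map; filter; length)
open import Data.List.Properties using (length-++; filter-++; filter-all; filter-none; ++-identityʳ)
open import Data.List.Membership.Propositional using (_∈_; _∉_)
open import Data.List.Membership.Propositional.Properties using (∈-++⁻; ∈-map⁻; ∈-filter⁻)
open import Data.List.Relation.Binary.Subset.Propositional using (_⊆_)
open import Data.List.Relation.Unary.Any using (here; there)
open import Data.List.Relation.Unary.All as All using (All; []; _∷_; all?)
open import Data.List.Relation.Unary.Unique.Propositional using (Unique)
open import Data.List.Relation.Unary.AllPairs using (_∷_)
open import Data.Product using (_×_; _,_; proj₁; proj₂; ∃-syntax)
open import Data.Sum using (inj₁; inj₂)
open import Function using (_∘_)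
open import Induction.WellFounded using (WellFounded; Acc; acc; module Subrelation)
import Relation.Binary.Construct.On as On
open import Relation.Binary.Lattice.Structures using (IsLattice)
open import Relation.Binary.PropositionalEquality using (_≡_; _≢_; refl; sym; trans; cong; cong₂; module ≡-Reasoning)
open import Relation.Nullary using (Dec; yes; no; ¬_; contradiction)
open import Relation.Nullary.Decidable using (_×-dec_; ¬?; decidable-stable)
open import Relation.Unary using (Pred; Decidable)
import Algebra.Properties.CommutativeSemigroup ℤP.+-commutativeSemigroup as +-Semigroup
import Algebra.Properties.CommutativeSemigroup ℤP.*-commutativeSemigroup as *-Semigroup
import Data.List.Membership.DecPropositional as DecMembership

open ≡-Reasoning

⟦_⟧ : {P : Set} → Dec P → ℤ
⟦ yes _ ⟧ = 1ℤ
⟦ no  _ ⟧ = 0ℤ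

⟦⟧-yes : {P : Set} (p : Dec P) → P → ⟦ p ⟧ ≡ 1ℤ
⟦⟧-yes (yes _) _  = refl
⟦⟧-yes (no ¬p) p = contradiction p ¬p

⟦⟧-*-zero : {P : Set} (p : Dec P) {i : ℤ} → (P → i ≡ 0ℤ) → ⟦ p ⟧ * i ≡ 0ℤ
⟦⟧-*-zero (yes p) i≡0 = trans (ℤP.*-identityˡ _) (i≡0 p)
⟦⟧-*-zero (no  _) _   = refl

⟦⟧-cong : {P Q : Set} (p : Dec P) (q : Dec Q) → (P → Q) → (Q → P) → ⟦ p ⟧ ≡ ⟦ q ⟧
⟦⟧-cong (yes _) (yes _) _   _   = refl
⟦⟧-cong (yes p) (no ¬q) p→q _   = contradiction (p→q p) ¬q
⟦⟧-cong (no ¬p) (yes q) _   q→p = contradiction (q→p q) ¬p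
⟦⟧-cong (no _)  (no _)  _   _   = refl

⟦×-dec⟧ : {P Q : Set} (p : Dec P) (q : Dec Q) → ⟦ p ×-dec q ⟧ ≡ ⟦ p ⟧ * ⟦ q ⟧
⟦×-dec⟧ (yes _) (yes _) = refl
⟦×-dec⟧ (yes _) (no  _) = refl
⟦×-dec⟧ (no  _) _       = refl

⟦¬?⟧ : {P : Set} (p : Dec P) → ⟦ ¬? p ⟧ ≡ 1ℤ - ⟦ p ⟧
⟦¬?⟧ (yes _) = refl
⟦¬?⟧ (no  _) = refl

⟦all?-∷⟧ : {A : Set} {P : Pred A 0ℓ} (P? : Decidable P) (a : A) (as : List A) →
           ⟦ all? P? (a ∷ as) ⟧ ≡ ⟦ P? a ⟧ * ⟦ all? P? as ⟧
⟦all?-∷⟧ P? a as = begin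
  ⟦ all? P? (a ∷ as) ⟧          ≡⟨ ⟦⟧-cong (all? P? (a ∷ as)) (P? a ×-dec all? P? as) All.uncons (λ (p , ps) → p ∷ ps) ⟩
  ⟦ P? a ×-dec all? P? as ⟧     ≡⟨ ⟦×-dec⟧ (P? a) (all? P? as) ⟩
  ⟦ P? a ⟧ * ⟦ all? P? as ⟧     ∎

∑ : {A : Set} → (A → ℤ) → List A → ℤ
∑ f l = sumℤ (map f l)

module _ {A : Set} where

  ∑-++ : (f : A → ℤ) (l₁ l₂ : List A) → ∑ f (l₁ ++ l₂) ≡ ∑ f l₁ + ∑ f l₂
  ∑-++ f []       l₂ = sym (ℤP.+-identityˡ _)
  ∑-++ f (a ∷ l₁) l₂ = trans (cong (f a +_) (∑-++ f l₁ l₂)) (sym (ℤP.+-assoc (f a) _ _))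

  ∑-cong : {f g : A → ℤ} (l : List A) → (∀ {a} → a ∈ l → f a ≡ g a) → ∑ f l ≡ ∑ g l
  ∑-cong []      f≡g = refl
  ∑-cong (a ∷ l) f≡g = cong₂ _+_ (f≡g (here refl)) (∑-cong l (f≡g ∘ there))

  ∑-zero : (f : A → ℤ) (l : List A) → (∀ {a} → a ∈ l → f a ≡ 0ℤ) → ∑ f l ≡ 0ℤ
  ∑-zero f []      f≡0 = refl
  ∑-zero f (a ∷ l) f≡0 = cong₂ _+_ (f≡0 (here refl)) (∑-zero f l (f≡0 ∘ there))

  ∑-+ : (f g : A → ℤ) (l : List A) → ∑ (λ a → f a + g a) l ≡ ∑ f l + ∑ g l
  ∑-+ f g []      = refl
  ∑-+ f g (a ∷ l) = trans (cong (f a + g a +_) (∑-+ f g l)) (+-Semigroup.interchange (f a) (g a) (∑ f l) (∑ g l))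

  ∑-neg : (f : A → ℤ) (l : List A) → ∑ (λ a → - f a) l ≡ - ∑ f l
  ∑-neg f []      = refl
  ∑-neg f (a ∷ l) = trans (cong (- f a +_) (∑-neg f l)) (sym (ℤP.neg-distrib-+ (f a) (∑ f l)))

  ∑-sub : (f g : A → ℤ) (l : List A) → ∑ (λ a → f a - g a) l ≡ ∑ f l - ∑ g l
  ∑-sub f g l = trans (∑-+ f (-_ ∘ g) l) (cong (∑ f l +_) (∑-neg g l))

  ∑-*ˡ : (k : ℤ) (f : A → ℤ) (l : List A) → ∑ (λ a → k * f a) l ≡ k * ∑ f l
  ∑-*ˡ k f []      = sym (ℤP.*-zeroʳ k)
  ∑-*ˡ k f (a ∷ l) = trans (cong (k * f a +_) (∑-*ˡ k f l)) (sym (ℤP.*-distribˡ-+ k (f a) (∑ f l)))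

  ∑-*ʳ : (k : ℤ) (f : A → ℤ) (l : List A) → ∑ (λ a → f a * k) l ≡ ∑ f l * k
  ∑-*ʳ k f l = begin
    ∑ (λ a → f a * k) l  ≡⟨ ∑-cong l (λ {a} _ → ℤP.*-comm (f a) k) ⟩
    ∑ (λ a → k * f a) l  ≡⟨ ∑-*ˡ k f l ⟩
    k * ∑ f l            ≡⟨ ℤP.*-comm k (∑ f l) ⟩
    ∑ f l * k            ∎

  ∑-filter : {P : Pred A 0ℓ} (P? : Decidable P) (f : A → ℤ) (l : List A) →
             ∑ f (filter P? l) ≡ ∑ (λ a → ⟦ P? a ⟧ * f a) l
  ∑-filter P? f []      = refl
  ∑-filter P? f (a ∷ l) with P? a
  ... | yes _ = cong₂ _+_ (sym (ℤP.*-identityˡ (f a))) (∑-filter P? f l)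
  ... | no  _ = trans (∑-filter P? f l) (sym (ℤP.+-identityˡ _))

  ∑-support : (f : A → ℤ) {l : List A} {c : A} → Unique l → c ∈ l →
              (∀ {b} → b ≢ c → f b ≡ 0ℤ) → ∑ f l ≡ f c
  ∑-support f {a ∷ l} (a∉l ∷ _) (here refl) f≡0 = begin
    f a + ∑ f l  ≡⟨ cong (f a +_) (∑-zero f l (λ b∈l → f≡0 (λ b≡a → All.lookup a∉l b∈l (sym b≡a)))) ⟩
    f a + 0ℤ     ≡⟨ ℤP.+-identityʳ (f a) ⟩
    f a          ∎
  ∑-support f {a ∷ l} {c} (a∉l ∷ l!) (there c∈l) f≡0 = begin
    f a + ∑ f l  ≡⟨ cong₂ _+_ (f≡0 (All.lookup a∉l c∈l)) (∑-support f l! c∈l f≡0) ⟩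
    0ℤ + f c     ≡⟨ ℤP.+-identityˡ (f c) ⟩
    f c          ∎

  ∑-map : {B : Set} (f : B → ℤ) (g : A → B) (l : List A) → ∑ f (map g l) ≡ ∑ (f ∘ g) l
  ∑-map f g []      = refl
  ∑-map f g (a ∷ l) = cong (f (g a) +_) (∑-map f g l)

∑-swap : {A B : Set} (f : A → B → ℤ) (as : List A) (bs : List B) →
         ∑ (λ a → ∑ (f a) bs) as ≡ ∑ (λ b → ∑ (λ a → f a b) as) bs
∑-swap f []       bs = sym (∑-zero (λ _ → 0ℤ) bs (λ _ → refl))
∑-swap f (a ∷ as) bs = begin
  ∑ (f a) bs + ∑ (λ a → ∑ (f a) bs) as        ≡⟨ cong (∑ (f a) bs +_) (∑-swap f as bs) ⟩
  ∑ (f a) bs + ∑ (λ b → ∑ (λ a → f a b) as) bs ≡⟨ ∑-+ (f a) (λ b → ∑ (λ a → f a b) as) bs ⟨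
  ∑ (λ b → f a b + ∑ (λ a → f a b) as) bs      ∎

sgn : {A : Set} → List A → ℤ
sgn as = -1ℤ ^ length as

module _ {A : Set} where

  sgn-++ : (as bs : List A) → sgn (as ++ bs) ≡ sgn as * sgn bs
  sgn-++ as bs = trans (cong (-1ℤ ^_) (length-++ as)) (ℤP.^-distribˡ-+-* -1ℤ (length as) (length bs))

  ∈-subsets⇒⊆ : (l : List A) {as : List A} → as ∈ subsets l → as ⊆ l
  ∈-subsets⇒⊆ []      (here refl) ()
  ∈-subsets⇒⊆ (b ∷ l) as∈ a∈as with ∈-++⁻ (map (b ∷_) (subsets l)) as∈
  ... | inj₂ as∈′ = there (∈-subsets⇒⊆ l as∈′ a∈as)
  ... | inj₁ b∷bs∈ with ∈-map⁻ (b ∷_) b∷bs∈ | a∈as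
  ...   | _ , bs∈ , refl | here a≡b  = here a≡b
  ...   | _ , bs∈ , refl | there a∈bs = there (∈-subsets⇒⊆ l bs∈ a∈bs)

  ∑-subsets-∷ : (f : List A → ℤ) (a : A) (l : List A) →
                ∑ f (subsets (a ∷ l)) ≡ ∑ (f ∘ (a ∷_)) (subsets l) + ∑ f (subsets l)
  ∑-subsets-∷ f a l = begin
    ∑ f (map (a ∷_) (subsets l) ++ subsets l)         ≡⟨ ∑-++ f (map (a ∷_) (subsets l)) (subsets l) ⟩
    ∑ f (map (a ∷_) (subsets l)) + ∑ f (subsets l)    ≡⟨ cong (_+ ∑ f (subsets l)) (∑-map f (a ∷_) (subsets l)) ⟩
    ∑ (f ∘ (a ∷_)) (subsets l) + ∑ f (subsets l)      ∎

  ∑-subsets-++ : (f : List A → ℤ) (l₁ l₂ : List A) →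
    ∑ f (subsets (l₁ ++ l₂)) ≡ ∑ (λ as → ∑ (λ bs → f (as ++ bs)) (subsets l₂)) (subsets l₁)
  ∑-subsets-++ f []       l₂ = sym (ℤP.+-identityʳ _)
  ∑-subsets-++ f (a ∷ l₁) l₂ = begin
    ∑ f (subsets (a ∷ l₁ ++ l₂))
      ≡⟨ ∑-subsets-∷ f a (l₁ ++ l₂) ⟩
    ∑ (f ∘ (a ∷_)) (subsets (l₁ ++ l₂)) + ∑ f (subsets (l₁ ++ l₂))
      ≡⟨ cong₂ _+_ (∑-subsets-++ (f ∘ (a ∷_)) l₁ l₂) (∑-subsets-++ f l₁ l₂) ⟩
    ∑ (g ∘ (a ∷_)) (subsets l₁) + ∑ g (subsets l₁)
      ≡⟨ ∑-subsets-∷ g a l₁ ⟨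
    ∑ g (subsets (a ∷ l₁))
      ∎
    where
    g : List A → ℤ
    g as = ∑ (λ bs → f (as ++ bs)) (subsets l₂)

  ∑-subsets-all : {P : Pred A 0ℓ} (P? : Decidable P) (l : List A) →
    ∑ (λ as → ⟦ all? P? as ⟧ * sgn as) (subsets l) ≡ ⟦ all? (¬? ∘ P?) l ⟧
  ∑-subsets-all P? []      = refl
  ∑-subsets-all P? (a ∷ l) = begin
    ∑ T (subsets (a ∷ l))
      ≡⟨ ∑-subsets-∷ T a l ⟩
    ∑ (T ∘ (a ∷_)) (subsets l) + ∑ T (subsets l)
      ≡⟨ cong (_+ ∑ T (subsets l)) (∑-cong (subsets l) (λ {as} _ → T-∷ as)) ⟩
    ∑ (λ as → - ⟦ P? a ⟧ * T as) (subsets l) + ∑ T (subsets l)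
      ≡⟨ cong (_+ ∑ T (subsets l)) (∑-*ˡ (- ⟦ P? a ⟧) T (subsets l)) ⟩
    - ⟦ P? a ⟧ * ∑ T (subsets l) + ∑ T (subsets l)
      ≡⟨ cong (λ t → - ⟦ P? a ⟧ * t + t) (∑-subsets-all P? l) ⟩
    - ⟦ P? a ⟧ * ⟦ all? (¬? ∘ P?) l ⟧ + ⟦ all? (¬? ∘ P?) l ⟧
      ≡⟨ factor ⟦ P? a ⟧ ⟦ all? (¬? ∘ P?) l ⟧ ⟩
    (1ℤ - ⟦ P? a ⟧) * ⟦ all? (¬? ∘ P?) l ⟧
      ≡⟨ cong (_* ⟦ all? (¬? ∘ P?) l ⟧) (⟦¬?⟧ (P? a)) ⟨
    ⟦ ¬? (P? a) ⟧ * ⟦ all? (¬? ∘ P?) l ⟧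
      ≡⟨ ⟦all?-∷⟧ (¬? ∘ P?) a l ⟨
    ⟦ all? (¬? ∘ P?) (a ∷ l) ⟧
      ∎
    where
    T : List A → ℤ
    T as = ⟦ all? P? as ⟧ * sgn as

    move-sign : ∀ p q s → p * q * (-1ℤ * s) ≡ - p * (q * s)
    move-sign = solve-∀

    factor : ∀ p t → - p * t + t ≡ (1ℤ - p) * t
    factor = solve-∀

    T-∷ : (as : List A) → T (a ∷ as) ≡ - ⟦ P? a ⟧ * T as
    T-∷ as = begin
      ⟦ all? P? (a ∷ as) ⟧ * (-1ℤ * sgn as)         ≡⟨ cong (_* (-1ℤ * sgn as)) (⟦all?-∷⟧ P? a as) ⟩
      ⟦ P? a ⟧ * ⟦ all? P? as ⟧ * (-1ℤ * sgn as)    ≡⟨ move-sign ⟦ P? a ⟧ ⟦ all? P? as ⟧ (sgn as) ⟩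
      - ⟦ P? a ⟧ * (⟦ all? P? as ⟧ * sgn as)        ∎

module _ {A : Set} {P Q : Pred A 0ℓ} (P? : Decidable P) (Q? : Decidable Q) (P⇒Q : ∀ {a} → P a → Q a) where

  length-filter-mono : (l : List A) → length (filter P? l) ℕ.≤ length (filter Q? l)
  length-filter-mono []      = z≤n
  length-filter-mono (a ∷ l) with P? a | Q? a
  ... | yes _  | yes _  = s≤s (length-filter-mono l)
  ... | yes Pa | no ¬Qa = contradiction (P⇒Q Pa) ¬Qa
  ... | no _   | yes _  = ℕP.m≤n⇒m≤1+n (length-filter-mono l)
  ... | no _   | no _   = length-filter-mono l

  length-filter-< : (l : List A) {c : A} → c ∈ l → Q c → ¬ P c → length (filter P? l) ℕ.< length (filter Q? l)
  length-filter-< (a ∷ l) (here refl) Qc ¬Pc with P? a | Q? a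
  ... | yes Pc | _      = contradiction Pc ¬Pc
  ... | no _   | yes _  = s≤s (length-filter-mono l)
  ... | no _   | no ¬Qc = contradiction Qc ¬Qc
  length-filter-< (a ∷ l) (there c∈l) Qc ¬Pc with P? a | Q? a
  ... | yes _  | yes _  = s≤s (length-filter-< l c∈l Qc ¬Pc)
  ... | yes Pa | no ¬Qa = contradiction (P⇒Q Pa) ¬Qa
  ... | no _   | yes _  = ℕP.m<n⇒m<1+n (length-filter-< l c∈l Qc ¬Pc)
  ... | no _   | no _   = length-filter-< l c∈l Qc ¬Pc

module _ (L : FiniteLattice) where
  open FiniteLattice L
  open IsLattice isLattice using (x≤x∨y; y≤x∨y; ∨-least; antisym) renaming (refl to ≤-refl; trans to ≤-trans)

  ≤-joinFrom : ∀ u A → u ≤ joinFrom L u A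
  ≤-joinFrom u []      = ≤-refl
  ≤-joinFrom u (a ∷ A) = ≤-trans (≤-joinFrom u A) (y≤x∨y a (joinFrom L u A))

  joinFrom-least : ∀ {u w} A → u ≤ w → All (_≤ w) A → joinFrom L u A ≤ w
  joinFrom-least []      u≤w []          = u≤w
  joinFrom-least (a ∷ A) u≤w (a≤w ∷ A≤w) = ∨-least a≤w (joinFrom-least A u≤w A≤w)

  joinFrom-≤⇒All : ∀ {u w} A → joinFrom L u A ≤ w → All (_≤ w) A
  joinFrom-≤⇒All []      _   = []
  joinFrom-≤⇒All (a ∷ A) ⋁≤w = ≤-trans (x≤x∨y a _) ⋁≤w ∷ joinFrom-≤⇒All A (≤-trans (y≤x∨y a _) ⋁≤w)

  module _ {u v : Carrier} {S : List Carrier} (cut : IsLowerCrossCut L u v S) where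

    none≤bottom : All (λ a → ¬ a ≤ u) S
    none≤bottom = All.tabulate λ a∈S a≤u →
      let (u≤a , _ , a≢u) = proj₁ (proj₂ cut) _ a∈S in a≢u (antisym a≤u u≤a)

    some≤ : ∀ {w} → u ≤ w → w ≤ v → u ≢ w → ∃[ a ] (a ∈ S × a ≤ w)
    some≤ {w} u≤w w≤v u≢w with DecMembership._∈?_ _≟_ w S
    ... | yes w∈S = w , w∈S , ≤-refl
    ... | no  w∉S = let (a , a∈S , a≤w , _) = proj₂ (proj₂ cut) w u≤w w≤v w∉S (u≢w ∘ sym) in a , a∈S , a≤w

    none≤⇒bottom : ∀ {w} → u ≤ w → w ≤ v → All (λ a → ¬ a ≤ w) S → u ≡ w
    none≤⇒bottom u≤w w≤v none≤w = decidable-stable (_ ≟ _) λ u≢w →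
      let (a , a∈S , a≤w) = some≤ u≤w w≤v u≢w in All.lookup none≤w a∈S a≤w

    ∑-crossCut : ∀ {w} → u ≤ w → w ≤ v →
      ∑ (λ A → ⟦ joinFrom L u A ≤? w ⟧ * sgn A) (subsets S) ≡ ⟦ u ≟ w ⟧
    ∑-crossCut {w} u≤w w≤v = begin
      ∑ (λ A → ⟦ joinFrom L u A ≤? w ⟧ * sgn A) (subsets S)
        ≡⟨ ∑-cong (subsets S) (λ {A} _ → cong (_* sgn A)
             (⟦⟧-cong (joinFrom L u A ≤? w) (all? (_≤? w) A) (joinFrom-≤⇒All A) (joinFrom-least A u≤w))) ⟩
      ∑ (λ A → ⟦ all? (_≤? w) A ⟧ * sgn A) (subsets S)
        ≡⟨ ∑-subsets-all (_≤? w) S ⟩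
      ⟦ all? (¬? ∘ (_≤? w)) S ⟧
        ≡⟨ ⟦⟧-cong (all? (¬? ∘ (_≤? w)) S) (u ≟ w) (none≤⇒bottom u≤w w≤v) (λ { refl → none≤bottom }) ⟩
      ⟦ u ≟ w ⟧
        ∎

  crossCuts-disjoint : ∀ {x y z S₁ S₂ a} → IsLowerCrossCut L x y S₁ → IsLowerCrossCut L y z S₂ →
                       a ∈ S₁ → a ∉ S₂
  crossCuts-disjoint cut₁ cut₂ a∈S₁ a∈S₂ =
    let (_ , a≤y , _)   = proj₁ (proj₂ cut₁) _ a∈S₁
        (y≤a , _ , a≢y) = proj₁ (proj₂ cut₂) _ a∈S₂
    in a≢y (antisym a≤y y≤a)

  [_,_] : Carrier → Carrier → List Carrier
  [ a , b ] = filter (λ t → a ≤? t ×-dec t ≤? b) elems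

  ∈[,]⁻ : ∀ {a b t} → t ∈ [ a , b ] → a ≤ t × t ≤ b
  ∈[,]⁻ {a} {b} t∈ = proj₂ (∈-filter⁻ (λ t → a ≤? t ×-dec t ≤? b) {xs = elems} t∈)

  ∑-[,]-support : (f : Carrier → ℤ) {a b : Carrier} (c : Carrier) →
    (∀ {t} → a ≤ t → t ≤ b → t ≢ c → f t ≡ 0ℤ) → ∑ f [ a , b ] ≡ ⟦ a ≤? c ×-dec c ≤? b ⟧ * f c
  ∑-[,]-support f {a} {b} c f≡0 = begin
    ∑ f [ a , b ]                                        ≡⟨ ∑-filter (λ t → a ≤? t ×-dec t ≤? b) f elems ⟩
    ∑ (λ t → ⟦ a ≤? t ×-dec t ≤? b ⟧ * f t) elems       ≡⟨ ∑-support _ elems-unique (elems-complete c) outside ⟩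
    ⟦ a ≤? c ×-dec c ≤? b ⟧ * f c                        ∎
    where
    outside : ∀ {t} → t ≢ c → ⟦ a ≤? t ×-dec t ≤? b ⟧ * f t ≡ 0ℤ
    outside {t} t≢c = ⟦⟧-*-zero (a ≤? t ×-dec t ≤? b) (λ (a≤t , t≤b) → f≡0 a≤t t≤b t≢c)

  ∑-[,]-support∈ : (f : Carrier → ℤ) {a b c : Carrier} → a ≤ c → c ≤ b →
    (∀ {t} → a ≤ t → t ≤ b → t ≢ c → f t ≡ 0ℤ) → ∑ f [ a , b ] ≡ f c
  ∑-[,]-support∈ f {a} {b} {c} a≤c c≤b f≡0 = begin
    ∑ f [ a , b ]                      ≡⟨ ∑-[,]-support f c f≡0 ⟩
    ⟦ a ≤? c ×-dec c ≤? b ⟧ * f c      ≡⟨ cong (_* f c) (⟦⟧-yes (a ≤? c ×-dec c ≤? b) (a≤c , c≤b)) ⟩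
    1ℤ * f c                           ≡⟨ ℤP.*-identityˡ (f c) ⟩
    f c                                ∎

  ∑-[,]-⟦≟⟧ : (f : Carrier → ℤ) {a b : Carrier} (c : Carrier) →
    ∑ (λ t → ⟦ c ≟ t ⟧ * f t) [ a , b ] ≡ ⟦ a ≤? c ×-dec c ≤? b ⟧ * f c
  ∑-[,]-⟦≟⟧ f {a} {b} c = begin
    ∑ (λ t → ⟦ c ≟ t ⟧ * f t) [ a , b ]
      ≡⟨ ∑-[,]-support (λ t → ⟦ c ≟ t ⟧ * f t) c
           (λ {t} _ _ t≢c → ⟦⟧-*-zero (c ≟ t) (λ c≡t → contradiction (sym c≡t) t≢c)) ⟩
    ⟦ a ≤? c ×-dec c ≤? b ⟧ * (⟦ c ≟ c ⟧ * f c)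
      ≡⟨ cong (λ p → ⟦ a ≤? c ×-dec c ≤? b ⟧ * (p * f c)) (⟦⟧-yes (c ≟ c) refl) ⟩
    ⟦ a ≤? c ×-dec c ≤? b ⟧ * (1ℤ * f c)
      ≡⟨ cong (⟦ a ≤? c ×-dec c ≤? b ⟧ *_) (ℤP.*-identityˡ (f c)) ⟩
    ⟦ a ≤? c ×-dec c ≤? b ⟧ * f c
      ∎

  ∑-[,]-restrict : (f : Carrier → ℤ) {a j b : Carrier} → a ≤ j →
    ∑ (λ t → ⟦ j ≤? t ⟧ * f t) [ a , b ] ≡ ∑ f [ j , b ]
  ∑-[,]-restrict f {a} {j} {b} a≤j = begin
    ∑ (λ t → ⟦ j ≤? t ⟧ * f t) [ a , b ]
      ≡⟨ ∑-filter (λ t → a ≤? t ×-dec t ≤? b) _ elems ⟩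
    ∑ (λ t → ⟦ a ≤? t ×-dec t ≤? b ⟧ * (⟦ j ≤? t ⟧ * f t)) elems
      ≡⟨ ∑-cong elems (λ {t} _ → pointwise t) ⟩
    ∑ (λ t → ⟦ j ≤? t ×-dec t ≤? b ⟧ * f t) elems
      ≡⟨ ∑-filter (λ t → j ≤? t ×-dec t ≤? b) f elems ⟨
    ∑ f [ j , b ]
      ∎
    where
    pointwise : ∀ t → ⟦ a ≤? t ×-dec t ≤? b ⟧ * (⟦ j ≤? t ⟧ * f t) ≡ ⟦ j ≤? t ×-dec t ≤? b ⟧ * f t
    pointwise t = begin
      ⟦ a ≤? t ×-dec t ≤? b ⟧ * (⟦ j ≤? t ⟧ * f t)
        ≡⟨ ℤP.*-assoc ⟦ a ≤? t ×-dec t ≤? b ⟧ ⟦ j ≤? t ⟧ (f t) ⟨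
      ⟦ a ≤? t ×-dec t ≤? b ⟧ * ⟦ j ≤? t ⟧ * f t
        ≡⟨ cong (_* f t) (⟦×-dec⟧ (a ≤? t ×-dec t ≤? b) (j ≤? t)) ⟨
      ⟦ (a ≤? t ×-dec t ≤? b) ×-dec j ≤? t ⟧ * f t
        ≡⟨ cong (_* f t) (⟦⟧-cong ((a ≤? t ×-dec t ≤? b) ×-dec j ≤? t) (j ≤? t ×-dec t ≤? b)
             (λ ((_ , t≤b) , j≤t) → j≤t , t≤b) (λ (j≤t , t≤b) → (≤-trans a≤j j≤t , t≤b) , j≤t)) ⟩
      ⟦ j ≤? t ×-dec t ≤? b ⟧ * f t
        ∎

  countBelow : Carrier → ℕ
  countBelow v = length (filter (_≤? v) elems)

  <⇒countBelow-< : ∀ {a b} → a < b → countBelow a ℕ.< countBelow b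
  <⇒countBelow-< {a} {b} (a≤b , a≢b) =
    length-filter-< (_≤? a) (_≤? b) (λ t≤a → ≤-trans t≤a a≤b) elems (elems-complete b) ≤-refl
                    (λ b≤a → a≢b (antisym a≤b b≤a))

  <-wellFounded : WellFounded _<_
  <-wellFounded = Subrelation.wellFounded <⇒countBelow-< (On.wellFounded countBelow ℕ-Induction.<-wellFounded)

  ∑-[,]-injective : ∀ {y z} (f g : Carrier → ℤ) →
    (∀ {v} → y ≤ v → v ≤ z → ∑ f [ y , v ] ≡ ∑ g [ y , v ]) → y ≤ z → f z ≡ g z
  ∑-[,]-injective {y} {z} f g ∑f≡∑g y≤z = ℤP.i-j≡0⇒i≡j (f z) (g z) (vanish (<-wellFounded z) y≤z ≤-refl)
    where
    d : Carrier → ℤ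
    d t = f t - g t

    vanish : ∀ {v} → Acc _<_ v → y ≤ v → v ≤ z → d v ≡ 0ℤ
    vanish {v} (acc below) y≤v v≤z = begin
      d v                              ≡⟨ ∑-[,]-support∈ d y≤v ≤-refl (λ y≤t t≤v t≢v →
                                            vanish (below (t≤v , t≢v)) y≤t (≤-trans t≤v v≤z)) ⟨
      ∑ d [ y , v ]                    ≡⟨ ∑-sub f g [ y , v ] ⟩
      ∑ f [ y , v ] - ∑ g [ y , v ]    ≡⟨ cong (_- ∑ g [ y , v ]) (∑f≡∑g y≤v v≤z) ⟩
      ∑ g [ y , v ] - ∑ g [ y , v ]    ≡⟨ ℤP.+-inverseʳ (∑ g [ y , v ]) ⟩
      0ℤ                               ∎

  δ₃≡⟦≟⟧*⟦≟⟧ : ∀ a b c → δ₃ L a b c ≡ ⟦ a ≟ b ⟧ * ⟦ b ≟ c ⟧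
  δ₃≡⟦≟⟧*⟦≟⟧ a b c with a ≟ b | b ≟ c
  ... | yes _ | yes _ = refl
  ... | yes _ | no  _ = refl
  ... | no  _ | _     = refl

  -- By ∑-joinSum below, joinSum u S is the Möbius function μ(u,·) on [u,v]
  -- when S is a lower cross-cut of [u,v].
  joinSum : Carrier → List Carrier → Carrier → ℤ
  joinSum u S t = ∑ (λ A → ⟦ joinFrom L u A ≟ t ⟧ * sgn A) (subsets S)

  ∑-joinSum : ∀ {u v S w} → IsLowerCrossCut L u v S → u ≤ w → w ≤ v →
              ∑ (joinSum u S) [ u , w ] ≡ ⟦ u ≟ w ⟧
  ∑-joinSum {u} {v} {S} {w} cut u≤w w≤v = begin
    ∑ (joinSum u S) [ u , w ]
      ≡⟨ ∑-swap (λ t A → ⟦ joinFrom L u A ≟ t ⟧ * sgn A) [ u , w ] (subsets S) ⟩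
    ∑ (λ A → ∑ (λ t → ⟦ joinFrom L u A ≟ t ⟧ * sgn A) [ u , w ]) (subsets S)
      ≡⟨ ∑-cong (subsets S) (λ {A} _ → ∑-at-join A) ⟩
    ∑ (λ A → ⟦ joinFrom L u A ≤? w ⟧ * sgn A) (subsets S)
      ≡⟨ ∑-crossCut cut u≤w w≤v ⟩
    ⟦ u ≟ w ⟧
      ∎
    where
    ∑-at-join : ∀ A → ∑ (λ t → ⟦ joinFrom L u A ≟ t ⟧ * sgn A) [ u , w ] ≡ ⟦ joinFrom L u A ≤? w ⟧ * sgn A
    ∑-at-join A = begin
      ∑ (λ t → ⟦ j ≟ t ⟧ * sgn A) [ u , w ]   ≡⟨ ∑-[,]-⟦≟⟧ (λ _ → sgn A) j ⟩
      ⟦ u ≤? j ×-dec j ≤? w ⟧ * sgn A          ≡⟨ cong (_* sgn A) (⟦⟧-cong (u ≤? j ×-dec j ≤? w) (j ≤? w)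
                                                    proj₂ (≤-joinFrom u A ,_)) ⟩
      ⟦ j ≤? w ⟧ * sgn A                       ∎
      where
      j : Carrier
      j = joinFrom L u A

  module _ {J : Carrier → Carrier → Carrier → ℤ} (isJ : IsJ L J) where

    ∑-J-first : ∀ {w y z S} → IsLowerCrossCut L y z S → w ≤ y → y ≤ z →
                ∑ (λ a → J a y z) [ w , y ] ≡ ⟦ w ≟ y ⟧ * joinSum y S z
    ∑-J-first {w} {y} {z} {S} cut w≤y y≤z =
      ∑-[,]-injective (λ b → ∑ (λ a → J a y b) [ w , y ]) (λ b → ⟦ w ≟ y ⟧ * joinSum y S b) sums y≤z
      where
      sums : ∀ {v} → y ≤ v → v ≤ z →
             ∑ (λ b → ∑ (λ a → J a y b) [ w , y ]) [ y , v ] ≡ ∑ (λ b → ⟦ w ≟ y ⟧ * joinSum y S b) [ y , v ]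
      sums {v} y≤v v≤z = begin
        ∑ (λ b → ∑ (λ a → J a y b) [ w , y ]) [ y , v ]  ≡⟨ ∑-swap (λ b a → J a y b) [ y , v ] [ w , y ] ⟩
        Jsum L J w y v                                   ≡⟨ isJ w y v w≤y y≤v ⟩
        δ₃ L w y v                                       ≡⟨ δ₃≡⟦≟⟧*⟦≟⟧ w y v ⟩
        ⟦ w ≟ y ⟧ * ⟦ y ≟ v ⟧                            ≡⟨ cong (⟦ w ≟ y ⟧ *_) (∑-joinSum cut y≤v v≤z) ⟨
        ⟦ w ≟ y ⟧ * ∑ (joinSum y S) [ y , v ]            ≡⟨ ∑-*ˡ ⟦ w ≟ y ⟧ (joinSum y S) [ y , v ] ⟨
        ∑ (λ b → ⟦ w ≟ y ⟧ * joinSum y S b) [ y , v ]    ∎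

    J≡joinSum*joinSum : ∀ {x y z S₁ S₂} → IsLowerCrossCut L x y S₁ → IsLowerCrossCut L y z S₂ →
                        x ≤ y → y ≤ z → J x y z ≡ joinSum x S₁ y * joinSum y S₂ z
    J≡joinSum*joinSum {x} {y} {z} {S₁} {S₂} cut₁ cut₂ x≤y y≤z = begin
      J x y z
        ≡⟨ ℤP.*-identityˡ (J x y z) ⟨
      1ℤ * J x y z
        ≡⟨ cong (_* J x y z) (⟦⟧-yes (x ≤? x ×-dec x ≤? y) (≤-refl , x≤y)) ⟨
      ⟦ x ≤? x ×-dec x ≤? y ⟧ * J x y z
        ≡⟨ ∑-[,]-⟦≟⟧ (λ t → J t y z) x ⟨
      ∑ (λ t → ⟦ x ≟ t ⟧ * J t y z) [ x , y ]
        ≡⟨ ∑-cong [ x , y ] (λ {t} t∈ → cong (_* J t y z)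
             (sym (∑-crossCut cut₁ (proj₁ (∈[,]⁻ t∈)) (proj₂ (∈[,]⁻ t∈))))) ⟩
      ∑ (λ t → ∑ (λ A → ⟦ joinFrom L x A ≤? t ⟧ * sgn A) (subsets S₁) * J t y z) [ x , y ]
        ≡⟨ ∑-cong [ x , y ] (λ {t} _ → ∑-*ʳ (J t y z) _ (subsets S₁)) ⟨
      ∑ (λ t → ∑ (λ A → ⟦ joinFrom L x A ≤? t ⟧ * sgn A * J t y z) (subsets S₁)) [ x , y ]
        ≡⟨ ∑-swap (λ t A → ⟦ joinFrom L x A ≤? t ⟧ * sgn A * J t y z) [ x , y ] (subsets S₁) ⟩
      ∑ (λ A → ∑ (λ t → ⟦ joinFrom L x A ≤? t ⟧ * sgn A * J t y z) [ x , y ]) (subsets S₁)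
        ≡⟨ ∑-cong (subsets S₁) (λ {A} A∈ → ∑-over-join A A∈) ⟩
      ∑ (λ A → ⟦ joinFrom L x A ≟ y ⟧ * sgn A * joinSum y S₂ z) (subsets S₁)
        ≡⟨ ∑-*ʳ (joinSum y S₂ z) (λ A → ⟦ joinFrom L x A ≟ y ⟧ * sgn A) (subsets S₁) ⟩
      joinSum x S₁ y * joinSum y S₂ z
        ∎
      where
      swap-first : ∀ p s q → p * s * q ≡ s * (p * q)
      swap-first = solve-∀

      ∑-over-join : ∀ A → A ∈ subsets S₁ →
        ∑ (λ t → ⟦ joinFrom L x A ≤? t ⟧ * sgn A * J t y z) [ x , y ] ≡ ⟦ joinFrom L x A ≟ y ⟧ * sgn A * joinSum y S₂ z
      ∑-over-join A A∈ = begin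
        ∑ (λ t → ⟦ j ≤? t ⟧ * sgn A * J t y z) [ x , y ]
          ≡⟨ ∑-cong [ x , y ] (λ {t} _ → swap-first ⟦ j ≤? t ⟧ (sgn A) (J t y z)) ⟩
        ∑ (λ t → sgn A * (⟦ j ≤? t ⟧ * J t y z)) [ x , y ]
          ≡⟨ ∑-*ˡ (sgn A) (λ t → ⟦ j ≤? t ⟧ * J t y z) [ x , y ] ⟩
        sgn A * ∑ (λ t → ⟦ j ≤? t ⟧ * J t y z) [ x , y ]
          ≡⟨ cong (sgn A *_) (∑-[,]-restrict (λ t → J t y z) (≤-joinFrom x A)) ⟩
        sgn A * ∑ (λ t → J t y z) [ j , y ]
          ≡⟨ cong (sgn A *_) (∑-J-first cut₂ j≤y y≤z) ⟩
        sgn A * (⟦ j ≟ y ⟧ * joinSum y S₂ z)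
          ≡⟨ swap-first ⟦ j ≟ y ⟧ (sgn A) (joinSum y S₂ z) ⟨
        ⟦ j ≟ y ⟧ * sgn A * joinSum y S₂ z
          ∎
        where
        j : Carrier
        j = joinFrom L x A

        j≤y : j ≤ y
        j≤y = joinFrom-least A x≤y
                (All.tabulate λ a∈A → proj₁ (proj₂ (proj₁ (proj₂ cut₁) _ (∈-subsets⇒⊆ S₁ A∈ a∈A))))

  crossCutSum≡joinSum*joinSum : ∀ {x y z S₁ S₂} → IsLowerCrossCut L x y S₁ → IsLowerCrossCut L y z S₂ →
                                crossCutSum L x y z S₁ S₂ ≡ joinSum x S₁ y * joinSum y S₂ z
  crossCutSum≡joinSum*joinSum {x} {y} {z} {S₁} {S₂} cut₁ cut₂ = begin
    crossCutSum L x y z S₁ S₂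
      ≡⟨ ∑-filter spans sgn (subsets (S₁ ++ S₂)) ⟩
    ∑ (λ A → ⟦ spans A ⟧ * sgn A) (subsets (S₁ ++ S₂))
      ≡⟨ ∑-subsets-++ (λ A → ⟦ spans A ⟧ * sgn A) S₁ S₂ ⟩
    ∑ (λ A₁ → ∑ (λ A₂ → ⟦ spans (A₁ ++ A₂) ⟧ * sgn (A₁ ++ A₂)) (subsets S₂)) (subsets S₁)
      ≡⟨ ∑-cong (subsets S₁) (λ {A₁} A₁∈ → ∑-cong (subsets S₂) (λ {A₂} A₂∈ → factorise A₁∈ A₂∈)) ⟩
    ∑ (λ A₁ → ∑ (λ A₂ → term₁ A₁ * term₂ A₂) (subsets S₂)) (subsets S₁)
      ≡⟨ ∑-cong (subsets S₁) (λ {A₁} _ → ∑-*ˡ (term₁ A₁) term₂ (subsets S₂)) ⟩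
    ∑ (λ A₁ → term₁ A₁ * joinSum y S₂ z) (subsets S₁)
      ≡⟨ ∑-*ʳ (joinSum y S₂ z) term₁ (subsets S₁) ⟩
    joinSum x S₁ y * joinSum y S₂ z
      ∎
    where
    spans : (A : List Carrier) → Dec ((joinFrom L x (_∩_ L A S₁) ≡ y) × (joinFrom L y (_∩_ L A S₂) ≡ z))
    spans A = joinFrom L x (_∩_ L A S₁) ≟ y ×-dec joinFrom L y (_∩_ L A S₂) ≟ z

    term₁ term₂ : List Carrier → ℤ
    term₁ A₁ = ⟦ joinFrom L x A₁ ≟ y ⟧ * sgn A₁
    term₂ A₂ = ⟦ joinFrom L y A₂ ≟ z ⟧ * sgn A₂

    ∩-⊆ : ∀ {A S} → A ⊆ S → _∩_ L A S ≡ A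
    ∩-⊆ {S = S} A⊆S = filter-all (λ a → DecMembership._∈?_ _≟_ a S) (All.tabulate A⊆S)

    ∩-disjoint : ∀ {A S} → All (_∉ S) A → _∩_ L A S ≡ []
    ∩-disjoint {S = S} A∉S = filter-none (λ a → DecMembership._∈?_ _≟_ a S) A∉S

    factorise : ∀ {A₁ A₂} → A₁ ∈ subsets S₁ → A₂ ∈ subsets S₂ →
                ⟦ spans (A₁ ++ A₂) ⟧ * sgn (A₁ ++ A₂) ≡ term₁ A₁ * term₂ A₂
    factorise {A₁} {A₂} A₁∈ A₂∈ = begin
      ⟦ spans (A₁ ++ A₂) ⟧ * sgn (A₁ ++ A₂)
        ≡⟨ cong₂ _*_ (⟦×-dec⟧ (joinFrom L x (_∩_ L (A₁ ++ A₂) S₁) ≟ y) (joinFrom L y (_∩_ L (A₁ ++ A₂) S₂) ≟ z))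
                     (sgn-++ A₁ A₂) ⟩
      ⟦ joinFrom L x (_∩_ L (A₁ ++ A₂) S₁) ≟ y ⟧ * ⟦ joinFrom L y (_∩_ L (A₁ ++ A₂) S₂) ≟ z ⟧ * (sgn A₁ * sgn A₂)
        ≡⟨ cong₂ (λ B₁ B₂ → ⟦ joinFrom L x B₁ ≟ y ⟧ * ⟦ joinFrom L y B₂ ≟ z ⟧ * (sgn A₁ * sgn A₂)) A∩S₁≡A₁ A∩S₂≡A₂ ⟩
      ⟦ joinFrom L x A₁ ≟ y ⟧ * ⟦ joinFrom L y A₂ ≟ z ⟧ * (sgn A₁ * sgn A₂)
        ≡⟨ *-Semigroup.interchange ⟦ joinFrom L x A₁ ≟ y ⟧ ⟦ joinFrom L y A₂ ≟ z ⟧ (sgn A₁) (sgn A₂) ⟩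
      term₁ A₁ * term₂ A₂
        ∎
      where
      A₁⊆S₁ : A₁ ⊆ S₁
      A₁⊆S₁ = ∈-subsets⇒⊆ S₁ A₁∈

      A₂⊆S₂ : A₂ ⊆ S₂
      A₂⊆S₂ = ∈-subsets⇒⊆ S₂ A₂∈

      A∩S₁≡A₁ : _∩_ L (A₁ ++ A₂) S₁ ≡ A₁
      A∩S₁≡A₁ = begin
        _∩_ L (A₁ ++ A₂) S₁              ≡⟨ filter-++ (λ a → DecMembership._∈?_ _≟_ a S₁) A₁ A₂ ⟩
        _∩_ L A₁ S₁ ++ _∩_ L A₂ S₁       ≡⟨ cong₂ _++_ (∩-⊆ A₁⊆S₁) (∩-disjoint (All.tabulate λ a∈A₂ a∈S₁ →
                                               crossCuts-disjoint cut₁ cut₂ a∈S₁ (A₂⊆S₂ a∈A₂))) ⟩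
        A₁ ++ []                         ≡⟨ ++-identityʳ A₁ ⟩
        A₁                               ∎

      A∩S₂≡A₂ : _∩_ L (A₁ ++ A₂) S₂ ≡ A₂
      A∩S₂≡A₂ = begin
        _∩_ L (A₁ ++ A₂) S₂              ≡⟨ filter-++ (λ a → DecMembership._∈?_ _≟_ a S₂) A₁ A₂ ⟩
        _∩_ L A₁ S₂ ++ _∩_ L A₂ S₂       ≡⟨ cong₂ _++_ (∩-disjoint (All.tabulate λ a∈A₁ →
                                               crossCuts-disjoint cut₁ cut₂ (A₁⊆S₁ a∈A₁))) (∩-⊆ A₂⊆S₂) ⟩
        A₂                               ∎

theorem5p9 : (L : FiniteLattice)
    → (J : FiniteLattice.Carrier L → FiniteLattice.Carrier L → FiniteLattice.Carrier L → ℤ)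
    → IsJ L J
    → (x y z : FiniteLattice.Carrier L)
    → FiniteLattice._≤_ L x y → FiniteLattice._≤_ L y z
    → (Sxy Syz : List (FiniteLattice.Carrier L))
    → IsLowerCrossCut L x y Sxy → IsLowerCrossCut L y z Syz
    → J x y z ≡ crossCutSum L x y z Sxy Syz
theorem5p9 L J isJ x y z x≤y y≤z Sxy Syz cut₁ cut₂ = begin
  J x y z                                  ≡⟨ J≡joinSum*joinSum L isJ cut₁ cut₂ x≤y y≤z ⟩
  joinSum L x Sxy y * joinSum L y Syz z    ≡⟨ crossCutSum≡joinSum*joinSum L cut₁ cut₂ ⟨
  crossCutSum L x y z Sxy Syz              ∎
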